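{- Let $(P,\le,\mu,\gamma)$ be a preordered heap and let $\tau\colon P\times P\to P$ be its target multiplication, $\tau(a,b)=\gamma(\mu(\gamma a,\gamma b))$. Then for every $a\in P$, the pairs of maps $(b\mapsto \mu(a,b),\ c\mapsto \tau(c,\gamma a))$ and $(b\mapsto \mu(b,a),\ c\mapsto \tau(\gamma a,c))$ are adjoint pairs (Galois connections). That is, for all $a,b,c\in P$: $\mu(a,b)\le c$ if and only if $b\le \tau(c,\gamma a)$; and $\mu(b,a)\le c$ if and only if $b\le \tau(\gamma a,c)$. In particular, $\tau(c,\gamma a)$ is a largest solution $x$ of $\mu(a,x)\le c$ and $\tau(\gamma a,c)$ is a largest solution $x$ of $\mu(x,a)\le c$.
   Context: A preorder is a set with a reflexive and transitive relation $\le$. A map $f\colon P\to P$ is antitone if $a\le b$ implies $f(b)\le f(a)$. Two monotone maps $L,R\colon P\to P$ form an adjoint pair (Galois connection) if $L b\le c \iff b\le R c$ for all $b,c$. A preordered heap is a structure $(P,\le,\mu,\gamma)$ where $(P,\le)$ is a preorder, $\mu\colon P\times P\to P$ (source multiplication) is monotone in each argument, and $\gamma\colon P\to P$ (involution) is antitone, such that: (A1) $\gamma(\gamma(a))=a$ for all $a\in P$; (A2a, left regularity) $\mu(a,\gamma(\mu(\gamma b,a)))\le b$ for all $a,b\in P$; (A2b, right regularity) $\mu(\gamma(\mu(a,\gamma b)),a)\le b$ for all $a,b\in P$. Commutativity of $\mu$ is not assumed. The target multiplication is $\tau(a,b)=\gamma(\mu(\gamma a,\gamma b))$. -}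

module Defs where

open import Level using (Level; _⊔_; suc)
open import Relation.Binary.PropositionalEquality using (_≡_)
open import Relation.Binary.Bundles using (Preorder)
open import Function.Bundles using (_⇔_)

record PreorderedHeap (c ℓ : Level) : Set (Level.suc (c ⊔ ℓ)) where
  field
    P    : Set c
    _≤_  : P → P → Set ℓ
    ≤-refl  : ∀ {a} → a ≤ a
    ≤-trans : ∀ {a b c} → a ≤ b → b ≤ c → a ≤ c
    μ    : P → P → P
    γ    : P → P
    μ-monoˡ : ∀ {a a′} b → a ≤ a′ → μ a b ≤ μ a′ b
    μ-monoʳ : ∀ a {b b′} → b ≤ b′ → μ a b ≤ μ a b′
    γ-anti  : ∀ {a b} → a ≤ b → γ b ≤ γ a
    γ-invol : ∀ a → γ (γ a) ≡ a
    reg-left  : ∀ a b → μ a (γ (μ (γ b) a)) ≤ b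
    reg-right : ∀ a b → μ (γ (μ a (γ b))) a ≤ b

  τ : P → P → P
  τ a b = γ (μ (γ a) (γ b))

record AdjointPair {c ℓ : Level} (H : PreorderedHeap c ℓ) (L R : PreorderedHeap.P H → PreorderedHeap.P H) : Set (c ⊔ ℓ) where
  open PreorderedHeap H
  field
    L-mono : ∀ {b b′} → b ≤ b′ → L b ≤ L b′
    R-mono : ∀ {b b′} → b ≤ b′ → R b ≤ R b′
    adjunction : ∀ b c → (L b ≤ c) ⇔ (b ≤ R c)

-- Regularity makes μ(γ c, a) a bound for the inverse image of c under μ(a, -),
-- and the involution γ, being an antitone bijection, is self-adjoint; together
-- these give μ(a, b) ≤ c ⇔ b ≤ γ(μ(γ c, a)) = τ(c, γ a).  The right-hand
-- adjunction is the same statement for the heap with μ flipped, whose target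
-- multiplication is τ with its arguments swapped.
module Submission where

open import Defs
open import Level using (Level)
open import Data.Product using (_×_; _,_)
open import Function.Base using (flip)
open import Function.Bundles using (_⇔_; mk⇔)
open import Relation.Binary.PropositionalEquality using (_≡_; cong; subst; sym)

opposite : ∀ {c ℓ} → PreorderedHeap c ℓ → PreorderedHeap c ℓ
opposite H = record
  { P         = P
  ; _≤_       = _≤_
  ; ≤-refl    = ≤-refl
  ; ≤-trans   = ≤-trans
  ; μ         = flip μ
  ; γ         = γ
  ; μ-monoˡ   = λ b → μ-monoʳ b
  ; μ-monoʳ   = λ a → μ-monoˡ a
  ; γ-anti    = γ-anti
  ; γ-invol   = γ-invol
  ; reg-left  = reg-right
  ; reg-right = reg-left
  }
  where open PreorderedHeap H

AdjointPair-fromOpposite : ∀ {c ℓ} {H : PreorderedHeap c ℓ} {L R} →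
                           AdjointPair (opposite H) L R → AdjointPair H L R
AdjointPair-fromOpposite adj = record
  { L-mono = L-mono ; R-mono = R-mono ; adjunction = adjunction }
  where open AdjointPair adj

module Properties {c ℓ : Level} (H : PreorderedHeap c ℓ) where
  open PreorderedHeap H

  γ-swap : ∀ {a b} → a ≤ γ b → b ≤ γ a
  γ-swap {a} {b} a≤γb = subst (_≤ γ a) (γ-invol b) (γ-anti a≤γb)

  τ-monoˡ : ∀ {a a′} b → a ≤ a′ → τ a b ≤ τ a′ b
  τ-monoˡ b a≤a′ = γ-anti (μ-monoˡ (γ b) (γ-anti a≤a′))

  τ-γʳ : ∀ a c → τ c (γ a) ≡ γ (μ (γ c) a)
  τ-γʳ a c = cong (λ x → γ (μ (γ c) x)) (γ-invol a)

  μ-residualʳ : ∀ a b c → (μ a b ≤ c) ⇔ (b ≤ γ (μ (γ c) a))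
  μ-residualʳ a b c = mk⇔ to from
    where
    reg-right′ : μ (γ (μ a b)) a ≤ γ b
    reg-right′ = subst (λ x → μ (γ (μ a x)) a ≤ γ b) (γ-invol b) (reg-right a (γ b))

    to : μ a b ≤ c → b ≤ γ (μ (γ c) a)
    to μab≤c = γ-swap (≤-trans (μ-monoˡ a (γ-anti μab≤c)) reg-right′)

    from : b ≤ γ (μ (γ c) a) → μ a b ≤ c
    from b≤ = ≤-trans (μ-monoʳ a b≤) (reg-left a c)

  μ-τ-adjointʳ : ∀ a → AdjointPair H (λ b → μ a b) (λ x → τ x (γ a))
  μ-τ-adjointʳ a = record
    { L-mono     = μ-monoʳ a
    ; R-mono     = τ-monoˡ (γ a)
    ; adjunction = λ b c → subst (λ x → (μ a b ≤ c) ⇔ (b ≤ x)) (sym (τ-γʳ a c))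
                                 (μ-residualʳ a b c)
    }

theorem1 : ∀ {c ℓ : Level} (H : PreorderedHeap c ℓ) →
    let open PreorderedHeap H in
    ∀ (a : P) →
    AdjointPair H (λ b → μ a b) (λ x → τ x (γ a))
    × AdjointPair H (λ b → μ b a) (λ x → τ (γ a) x)
theorem1 H a =
  Properties.μ-τ-adjointʳ H a ,
  AdjointPair-fromOpposite (Properties.μ-τ-adjointʳ (opposite H) a)
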